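{- In any execution of Algorithm 1 (described in the context), for every node $v$, at every point of time $\rho_{cw}(v)\le\mathrm{ID}_{\max}$.
   Context: Oriented ring of $n$ nodes, content-oblivious asynchronous model (content-free pulses, delivered after arbitrary finite delays, never lost or injected; each node has an incoming queue per port). Each node $v$ has a unique positive integer ID $\mathrm{ID}(v)$; $\mathrm{ID}_{\max}=\max_v\mathrm{ID}(v)$. $\rho_{cw}(v)$ is the number of clockwise (CW) pulses node $v$ has received (consumed from its queue), initially 0. Algorithm 1 at node $v$: first send one CW pulse; then loop forever: if a CW pulse is waiting, consume it (incrementing $\rho_{cw}(v)$); then if $\rho_{cw}(v)=\mathrm{ID}(v)$ set state to Leader and send nothing, otherwise set state to Non-Leader and send one CW pulse. -}

module Defs where

open import Data.Nat using (ℕ; zero; suc; _⊔_; NonZero) renaming (_≟_ to _≟ℕ_)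
open import Data.Nat.DivMod using (_mod_)
open import Data.Fin using (Fin; toℕ; _≟_) renaming (zero to fzero; suc to fsuc)
open import Data.Bool using (Bool; true; false)
open import Relation.Nullary using (yes; no)
open import Relation.Binary.PropositionalEquality using (_≡_)
open import Relation.Binary.Construct.Closure.ReflexiveTransitive using (Star)

idMax : ∀ {n} → (Fin n → ℕ) → ℕ
idMax {zero}  f = 0
idMax {suc n} f = f fzero ⊔ idMax (λ i → f (fsuc i))

cwNext : ∀ {n} .{{_ : NonZero n}} → Fin n → Fin n
cwNext {n} i = suc (toℕ i) mod n

upd : ∀ {n} {A : Set} → Fin n → A → (Fin n → A) → Fin n → A
upd i a f j with j ≟ i
... | yes _ = a
... | no  _ = f j

data Status : Set where
  undecided leader nonLeader : Status

-- Global configuration of the ring.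
-- transit v : CW pulses sent to v, not yet delivered into v's CW incoming queue
-- queue   v : CW pulses waiting in v's CW incoming queue (not yet consumed)
-- rho     v : ρ_cw(v), number of CW pulses consumed by v
-- started v : whether v has executed its initial "send one CW pulse"
record Config (n : ℕ) : Set where
  constructor cfg
  field
    started : Fin n → Bool
    rho     : Fin n → ℕ
    status  : Fin n → Status
    transit : Fin n → ℕ
    queue   : Fin n → ℕ
open Config public

initial : ∀ {n} → Config n
initial = cfg (λ _ → false) (λ _ → 0) (λ _ → undecided) (λ _ → 0) (λ _ → 0)

sendCW : ∀ {n} .{{_ : NonZero n}} → Fin n → Config n → Config n
sendCW v c = record c { transit = upd (cwNext v) (suc (transit c (cwNext v))) (transit c) }

startStep : ∀ {n} .{{_ : NonZero n}} → Fin n → Config n → Config n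
startStep v c = sendCW v (record c { started = upd v true (started c) })

deliverStep : ∀ {n} → Fin n → ℕ → Config n → Config n
deliverStep v t c = record c { transit = upd v t (transit c)
                             ; queue   = upd v (suc (queue c v)) (queue c) }

-- one loop iteration of v in which a waiting CW pulse is consumed
-- (q = remaining queue length after consumption)
consumeStep : ∀ {n} .{{_ : NonZero n}} → (Fin n → ℕ) → Fin n → ℕ → Config n → Config n
consumeStep ID v q c with suc (rho c v) ≟ℕ ID v
... | yes _ = record c' { status = upd v leader (status c) }
  where c' = record c { queue = upd v q (queue c) ; rho = upd v (suc (rho c v)) (rho c) }
... | no  _ = sendCW v (record c' { status = upd v nonLeader (status c) })
  where c' = record c { queue = upd v q (queue c) ; rho = upd v (suc (rho c v)) (rho c) }

data Step {n : ℕ} .{{_ : NonZero n}} (ID : Fin n → ℕ) : Config n → Config n → Set where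
  start   : ∀ {c} v → started c v ≡ false → Step ID c (startStep v c)
  deliver : ∀ {c} v t → transit c v ≡ suc t → Step ID c (deliverStep v t c)
  consume : ∀ {c} v q → started c v ≡ true → queue c v ≡ suc q →
            Step ID c (consumeStep ID v q c)

Reachable : ∀ {n} .{{_ : NonZero n}} → (Fin n → ℕ) → Config n → Set
Reachable ID c = Star (Step ID) initial c

-- Every pulse sent by p is, at any time, in transit to cwNext p, waiting in its queue, or consumed
-- by it.  So ρ(cwNext p) + queue + transit equals the number of pulses p has sent, which is
-- ρ(p) + 1 as long as ρ(p) < ID(p) and ρ(p) afterwards; in either case it is at most
-- max(ρ(p), ID(p)).  Hence a consumption can never push any ρ above ID_max, and the bound
-- ρ ≤ ID_max is preserved by every step of an execution.
module Submission where

open import Defs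
open import Data.Bool using (true; false; if_then_else_)
open import Data.Fin using (Fin; toℕ; _≟_; fromℕ; inject₁) renaming (zero to fzero; suc to fsuc)
open import Data.Fin.Properties using (toℕ-fromℕ<; toℕ-injective; toℕ<n; toℕ-fromℕ; toℕ-inject₁)
open import Data.Nat using (ℕ; suc; _+_; _≤_; z≤n; z<s; _≤?_; _%_; NonZero) renaming (_≟_ to _≟ℕ_)
open import Data.Nat.DivMod using (m<n⇒m%n≡m; n%n≡0)
open import Data.Nat.Properties
  using (module ≤-Reasoning; suc-injective; 1+n≢0; +-suc; m<m+n; m≤m+n; m≤m⊔n; m≤n⊔m;
         ≤-trans; ≤-reflexive; ≤-pred; <-irrefl; m≤n⇒m<n∨m≡n; m≤n⇒m≤1+n; ≰⇒>)
open import Data.Product using (_×_; _,_)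
open import Data.Sum using (_⊎_; inj₁; inj₂)
open import Function using (_∘_)
open import Function.Definitions using (Injective)
open import Relation.Nullary using (yes; no; contradiction)
open import Relation.Nullary.Decidable using (toSum)
open import Relation.Binary.PropositionalEquality
  using (_≡_; _≢_; refl; sym; trans; cong; module ≡-Reasoning)
open import Relation.Binary.Construct.Closure.ReflexiveTransitive using (Star; ε; _◅_)

upd-same : ∀ {n} {A : Set} (i : Fin n) (a : A) f → upd i a f i ≡ a
upd-same i a f with i ≟ i
... | yes _  = refl
... | no i≢i = contradiction refl i≢i

upd-other : ∀ {n} {A : Set} {i j : Fin n} (a : A) f → j ≢ i → upd i a f j ≡ f j
upd-other {i = i} {j} a f j≢i with j ≟ i
... | yes j≡i = contradiction j≡i j≢i
... | no  _   = refl

toℕ-cwNext : ∀ {n} .{{_ : NonZero n}} (i : Fin n) →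
             toℕ (cwNext i) ≡ suc (toℕ i) ⊎ (toℕ (cwNext i) ≡ 0 × suc (toℕ i) ≡ n)
toℕ-cwNext {n} i with m≤n⇒m<n∨m≡n (toℕ<n i)
... | inj₁ i+1<n = inj₁ (trans (toℕ-fromℕ< _) (m<n⇒m%n≡m i+1<n))
... | inj₂ i+1≡n = inj₂ (trans (toℕ-fromℕ< _) (trans (cong (_% n) i+1≡n) (n%n≡0 n)) , i+1≡n)

cwNext-injective : ∀ {n} .{{_ : NonZero n}} {i j : Fin n} → cwNext i ≡ cwNext j → i ≡ j
cwNext-injective {i = i} {j} e with toℕ-cwNext i | toℕ-cwNext j
... | inj₁ a       | inj₁ b       = toℕ-injective (suc-injective (trans (sym a) (trans (cong toℕ e) b)))
... | inj₂ (_ , a) | inj₂ (_ , b) = toℕ-injective (suc-injective (trans a (sym b)))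
... | inj₁ a       | inj₂ (b , _) = contradiction (trans (sym a) (trans (cong toℕ e) b)) 1+n≢0
... | inj₂ (a , _) | inj₁ b       = contradiction (trans (sym b) (trans (cong toℕ (sym e)) a)) 1+n≢0

cwPrev : ∀ {n} .{{_ : NonZero n}} → Fin n → Fin n
cwPrev {suc m} fzero    = fromℕ m
cwPrev {suc m} (fsuc k) = inject₁ k

cwNext-cwPrev : ∀ {n} .{{_ : NonZero n}} (w : Fin n) → cwNext (cwPrev w) ≡ w
cwNext-cwPrev {suc m} fzero = toℕ-injective (begin
  toℕ (cwNext (fromℕ m))       ≡⟨ toℕ-fromℕ< _ ⟩
  suc (toℕ (fromℕ m)) % suc m  ≡⟨ cong (λ k → suc k % suc m) (toℕ-fromℕ m) ⟩
  suc m % suc m                ≡⟨ n%n≡0 (suc m) ⟩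
  0                            ∎)
  where open ≡-Reasoning
cwNext-cwPrev {suc m} (fsuc k) = toℕ-injective (begin
  toℕ (cwNext (inject₁ k))      ≡⟨ toℕ-fromℕ< _ ⟩
  suc (toℕ (inject₁ k)) % suc m ≡⟨ cong (λ i → suc i % suc m) (toℕ-inject₁ k) ⟩
  suc (toℕ k) % suc m           ≡⟨ m<n⇒m%n≡m (toℕ<n (fsuc k)) ⟩
  suc (toℕ k)                   ∎)
  where open ≡-Reasoning

ID≤idMax : ∀ {n} (ID : Fin n → ℕ) v → ID v ≤ idMax ID
ID≤idMax ID fzero    = m≤m⊔n _ _
ID≤idMax ID (fsuc v) = ≤-trans (ID≤idMax (λ i → ID (fsuc i)) v) (m≤n⊔m _ _)

-- Pulses sent by a started node with identifier i after consuming r pulses: the initial one plus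
-- one per consumption, except for the consumption that makes ρ equal to i.
pulsesSent : ℕ → ℕ → ℕ
pulsesSent i r with i ≤? r
... | yes _ = r
... | no  _ = suc r

pulsesSent-zero : ∀ {i} → 1 ≤ i → pulsesSent i 0 ≡ 1
pulsesSent-zero {i} 1≤i with i ≤? 0
... | yes i≤0 = contradiction (≤-trans 1≤i i≤0) λ ()
... | no  _   = refl

pulsesSent-suc-≡ : ∀ {i r} → suc r ≡ i → pulsesSent i (suc r) ≡ pulsesSent i r
pulsesSent-suc-≡ {i} {r} refl with i ≤? suc r | i ≤? r
... | yes _   | no _    = refl
... | no i≰i  | _       = contradiction (≤-reflexive refl) i≰i
... | yes _   | yes i≤r = contradiction i≤r (<-irrefl refl)

pulsesSent-suc-≢ : ∀ {i r} → suc r ≢ i → pulsesSent i (suc r) ≡ suc (pulsesSent i r)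
pulsesSent-suc-≢ {i} {r} r+1≢i with i ≤? suc r | i ≤? r
... | yes _     | yes _   = refl
... | no  _     | no _    = refl
... | no i≰r+1  | yes i≤r = contradiction (m≤n⇒m≤1+n i≤r) i≰r+1
... | yes i≤r+1 | no i≰r with m≤n⇒m<n∨m≡n i≤r+1
...   | inj₁ i<r+1 = contradiction (≤-pred i<r+1) i≰r
...   | inj₂ i≡r+1 = contradiction (sym i≡r+1) r+1≢i

pulsesSent-lub : ∀ {i r m} → r ≤ m → i ≤ m → pulsesSent i r ≤ m
pulsesSent-lub {i} {r} r≤m i≤m with i ≤? r
... | yes _  = r≤m
... | no i≰r = ≤-trans (≰⇒> i≰r) i≤m

module PulseConservation {n : ℕ} .{{_ : NonZero n}} (ID : Fin n → ℕ) (ID-pos : ∀ v → 1 ≤ ID v) where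

  pulsesTo : Config n → Fin n → ℕ
  pulsesTo c w = rho c w + queue c w + transit c w

  sent : Config n → Fin n → ℕ
  sent c p = if started c p then pulsesSent (ID p) (rho c p) else 0

  record Invariant (c : Config n) : Set where
    field
      unstarted-rho≡0 : ∀ v → started c v ≡ false → rho c v ≡ 0
      rho≤idMax       : ∀ v → rho c v ≤ idMax ID
      conservation    : ∀ p → pulsesTo c (cwNext p) ≡ sent c p
  open Invariant

  sent-started : ∀ c v → started c v ≡ true → sent c v ≡ pulsesSent (ID v) (rho c v)
  sent-started c v st rewrite st = refl

  sent≤idMax : ∀ {c} → Invariant c → ∀ p → sent c p ≤ idMax ID
  sent≤idMax {c} I p with started c p
  ... | false = z≤n
  ... | true  = pulsesSent-lub (rho≤idMax I p) (ID≤idMax ID p)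

  pulsesTo-sendCW-self : ∀ v c → pulsesTo (sendCW v c) (cwNext v) ≡ suc (pulsesTo c (cwNext v))
  pulsesTo-sendCW-self v c rewrite upd-same (cwNext v) (suc (transit c (cwNext v))) (transit c) =
    +-suc (rho c (cwNext v) + queue c (cwNext v)) (transit c (cwNext v))

  pulsesTo-sendCW-other : ∀ v c p → p ≢ v → pulsesTo (sendCW v c) (cwNext p) ≡ pulsesTo c (cwNext p)
  pulsesTo-sendCW-other v c p p≢v
    rewrite upd-other (suc (transit c (cwNext v))) (transit c) (p≢v ∘ cwNext-injective) = refl

  initial-invariant : Invariant initial
  initial-invariant = record
    { unstarted-rho≡0 = λ _ _ → refl ; rho≤idMax = λ _ → z≤n ; conservation = λ _ → refl }

  start-invariant : ∀ {c} v → started c v ≡ false → Invariant c → Invariant (startStep v c)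
  start-invariant {c} v unstarted I = record
    { unstarted-rho≡0 = rho≡0 ; rho≤idMax = rho≤idMax I ; conservation = balance }
    where
    open ≡-Reasoning
    c₁ = record c { started = upd v true (started c) }

    rho≡0 : ∀ u → started c₁ u ≡ false → rho c u ≡ 0
    rho≡0 u e with toSum (u ≟ v)
    ... | inj₁ refl = contradiction (trans (sym (upd-same v true (started c))) e) λ ()
    ... | inj₂ u≢v  = unstarted-rho≡0 I u (trans (sym (upd-other true (started c) u≢v)) e)

    balance : ∀ p → pulsesTo (sendCW v c₁) (cwNext p) ≡ sent c₁ p
    balance p with toSum (p ≟ v)
    ... | inj₁ refl = begin
      pulsesTo (sendCW v c₁) (cwNext v) ≡⟨ pulsesTo-sendCW-self v c₁ ⟩
      suc (pulsesTo c (cwNext v))       ≡⟨ cong suc (conservation I v) ⟩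
      suc (sent c v)                    ≡⟨ cong (λ b → suc (if b then _ else 0)) unstarted ⟩
      1                                 ≡⟨ sym (pulsesSent-zero (ID-pos v)) ⟩
      pulsesSent (ID v) 0               ≡⟨ cong (pulsesSent (ID v)) (sym (unstarted-rho≡0 I v unstarted)) ⟩
      pulsesSent (ID v) (rho c v)       ≡⟨ sym (sent-started c₁ v (upd-same v true (started c))) ⟩
      sent c₁ v                         ∎
    ... | inj₂ p≢v = begin
      pulsesTo (sendCW v c₁) (cwNext p) ≡⟨ pulsesTo-sendCW-other v c₁ p p≢v ⟩
      pulsesTo c (cwNext p)             ≡⟨ conservation I p ⟩
      sent c p                          ≡⟨ cong (λ b → if b then _ else 0) (sym (upd-other true (started c) p≢v)) ⟩
      sent c₁ p                         ∎

  deliver-invariant : ∀ {c} v t → transit c v ≡ suc t → Invariant c → Invariant (deliverStep v t c)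
  deliver-invariant {c} v t in-transit I = record
    { unstarted-rho≡0 = unstarted-rho≡0 I
    ; rho≤idMax       = rho≤idMax I
    ; conservation    = λ p → trans (pulsesTo-delivered (cwNext p)) (conservation I p)
    }
    where
    pulsesTo-delivered : ∀ w → pulsesTo (deliverStep v t c) w ≡ pulsesTo c w
    pulsesTo-delivered w with toSum (w ≟ v)
    ... | inj₁ refl
      rewrite upd-same v t (transit c) | upd-same v (suc (queue c v)) (queue c) | in-transit =
        trans (cong (_+ t) (+-suc (rho c v) (queue c v))) (sym (+-suc (rho c v + queue c v) t))
    ... | inj₂ w≢v rewrite upd-other t (transit c) w≢v | upd-other (suc (queue c v)) (queue c) w≢v = refl

  consumed : Config n → Fin n → ℕ → Config n
  consumed c v q = record c { queue = upd v q (queue c) ; rho = upd v (suc (rho c v)) (rho c) }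

  pulsesTo-consumed : ∀ c {v q} → queue c v ≡ suc q → ∀ w → pulsesTo (consumed c v q) w ≡ pulsesTo c w
  pulsesTo-consumed c {v} {q} waiting w with toSum (w ≟ v)
  ... | inj₁ refl rewrite upd-same v q (queue c) | upd-same v (suc (rho c v)) (rho c) | waiting =
    cong (_+ transit c v) (sym (+-suc (rho c v) q))
  ... | inj₂ w≢v rewrite upd-other q (queue c) w≢v | upd-other (suc (rho c v)) (rho c) w≢v = refl

  sent-consumed-self : ∀ c {v} q → started c v ≡ true →
                       sent (consumed c v q) v ≡ pulsesSent (ID v) (suc (rho c v))
  sent-consumed-self c {v} q st rewrite st = cong (pulsesSent (ID v)) (upd-same v (suc (rho c v)) (rho c))

  sent-consumed-other : ∀ c {v} q p → p ≢ v → sent (consumed c v q) p ≡ sent c p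
  sent-consumed-other c {v} q p p≢v =
    cong (λ r → if started c p then pulsesSent (ID p) r else 0) (upd-other (suc (rho c v)) (rho c) p≢v)

  -- The consumed pulse was sent by cwPrev v, which has sent at most ID_max pulses.
  waiting⇒suc-rho≤idMax : ∀ {c v q} → queue c v ≡ suc q → Invariant c → suc (rho c v) ≤ idMax ID
  waiting⇒suc-rho≤idMax {c} {v} {q} waiting I = begin
    suc (rho c v)                   ≤⟨ ≤-trans (m<m+n (rho c v) z<s) (m≤m+n _ (transit c v)) ⟩
    rho c v + suc q + transit c v   ≡⟨ cong (λ k → rho c v + k + transit c v) (sym waiting) ⟩
    pulsesTo c v                    ≡⟨ cong (pulsesTo c) (sym (cwNext-cwPrev v)) ⟩
    pulsesTo c (cwNext (cwPrev v))  ≡⟨ conservation I (cwPrev v) ⟩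
    sent c (cwPrev v)               ≤⟨ sent≤idMax I (cwPrev v) ⟩
    idMax ID                        ∎
    where open ≤-Reasoning

  consumed-unstarted-rho≡0 : ∀ {c v} q → started c v ≡ true → Invariant c →
                             ∀ u → started c u ≡ false → rho (consumed c v q) u ≡ 0
  consumed-unstarted-rho≡0 {c} {v} q st I u unstarted with toSum (u ≟ v)
  ... | inj₁ refl = contradiction (trans (sym st) unstarted) λ ()
  ... | inj₂ u≢v  = trans (upd-other (suc (rho c v)) (rho c) u≢v) (unstarted-rho≡0 I u unstarted)

  consumed-rho≤idMax : ∀ {c v q} → queue c v ≡ suc q → Invariant c → ∀ u → rho (consumed c v q) u ≤ idMax ID
  consumed-rho≤idMax {c} {v} waiting I u with toSum (u ≟ v)
  ... | inj₁ refl rewrite upd-same v (suc (rho c v)) (rho c) = waiting⇒suc-rho≤idMax waiting I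
  ... | inj₂ u≢v  rewrite upd-other (suc (rho c v)) (rho c) u≢v = rho≤idMax I u

  consume-invariant : ∀ {c} v q → started c v ≡ true → queue c v ≡ suc q → Invariant c →
                      Invariant (consumeStep ID v q c)
  consume-invariant {c} v q st waiting I with suc (rho c v) ≟ℕ ID v
  ... | yes r+1≡ID = record
    { unstarted-rho≡0 = consumed-unstarted-rho≡0 q st I
    ; rho≤idMax       = consumed-rho≤idMax waiting I
    ; conservation    = balance
    }
    where
    open ≡-Reasoning
    balance : ∀ p → pulsesTo (consumed c v q) (cwNext p) ≡ sent (consumed c v q) p
    balance p with toSum (p ≟ v)
    ... | inj₁ refl = begin
      pulsesTo (consumed c v q) (cwNext v) ≡⟨ pulsesTo-consumed c waiting (cwNext v) ⟩
      pulsesTo c (cwNext v)                ≡⟨ conservation I v ⟩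
      sent c v                             ≡⟨ sent-started c v st ⟩
      pulsesSent (ID v) (rho c v)          ≡⟨ sym (pulsesSent-suc-≡ r+1≡ID) ⟩
      pulsesSent (ID v) (suc (rho c v))    ≡⟨ sym (sent-consumed-self c q st) ⟩
      sent (consumed c v q) v              ∎
    ... | inj₂ p≢v = begin
      pulsesTo (consumed c v q) (cwNext p) ≡⟨ pulsesTo-consumed c waiting (cwNext p) ⟩
      pulsesTo c (cwNext p)                ≡⟨ conservation I p ⟩
      sent c p                             ≡⟨ sym (sent-consumed-other c q p p≢v) ⟩
      sent (consumed c v q) p              ∎
  ... | no r+1≢ID = record
    { unstarted-rho≡0 = consumed-unstarted-rho≡0 q st I
    ; rho≤idMax       = consumed-rho≤idMax waiting I
    ; conservation    = balance
    }
    where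
    open ≡-Reasoning
    c₁ = consumed c v q
    balance : ∀ p → pulsesTo (sendCW v c₁) (cwNext p) ≡ sent c₁ p
    balance p with toSum (p ≟ v)
    ... | inj₁ refl = begin
      pulsesTo (sendCW v c₁) (cwNext v)   ≡⟨ pulsesTo-sendCW-self v c₁ ⟩
      suc (pulsesTo c₁ (cwNext v))        ≡⟨ cong suc (pulsesTo-consumed c waiting (cwNext v)) ⟩
      suc (pulsesTo c (cwNext v))         ≡⟨ cong suc (conservation I v) ⟩
      suc (sent c v)                      ≡⟨ cong suc (sent-started c v st) ⟩
      suc (pulsesSent (ID v) (rho c v))   ≡⟨ sym (pulsesSent-suc-≢ r+1≢ID) ⟩
      pulsesSent (ID v) (suc (rho c v))   ≡⟨ sym (sent-consumed-self c q st) ⟩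
      sent c₁ v                           ∎
    ... | inj₂ p≢v = begin
      pulsesTo (sendCW v c₁) (cwNext p)   ≡⟨ pulsesTo-sendCW-other v c₁ p p≢v ⟩
      pulsesTo c₁ (cwNext p)              ≡⟨ pulsesTo-consumed c waiting (cwNext p) ⟩
      pulsesTo c (cwNext p)               ≡⟨ conservation I p ⟩
      sent c p                            ≡⟨ sym (sent-consumed-other c q p p≢v) ⟩
      sent c₁ p                           ∎

  step-invariant : ∀ {c c′} → Step ID c c′ → Invariant c → Invariant c′
  step-invariant (start v unstarted)       = start-invariant v unstarted
  step-invariant (deliver v t in-transit)  = deliver-invariant v t in-transit
  step-invariant (consume v q st waiting)  = consume-invariant v q st waiting

  execution-invariant : ∀ {c c′} → Star (Step ID) c c′ → Invariant c → Invariant c′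
  execution-invariant ε        I = I
  execution-invariant (s ◅ ss) I = execution-invariant ss (step-invariant s I)

  reachable-invariant : ∀ {c} → Reachable ID c → Invariant c
  reachable-invariant r = execution-invariant r initial-invariant

corollary3p9 : (n : ℕ) .{{_ : NonZero n}} (ID : Fin n → ℕ) →
               Injective _≡_ _≡_ ID → (∀ v → 1 ≤ ID v) →
               ∀ c → Reachable ID c → ∀ v → rho c v ≤ idMax ID
corollary3p9 n ID _ ID-pos c reachable = Invariant.rho≤idMax (reachable-invariant reachable)
  where open PulseConservation ID ID-pos
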